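{- For every integer $n\ge 1$ and indeterminates $y, q$, the following identity of rational functions holds: $$\sum_{i=1}^n{n \brack i}\frac{(-1)^{i-1} q^{\binom{i+1}{2}}}{1-yq^i}=\sum_{i=1}^{n}\frac{q^{i}\,(q;q)_{i-1}}{(yq;q)_{i}}.$$
   Context: For an indeterminate $w$ and $k\in\mathbb{N}$, $(w;q)_k=(1-w)(1-wq)\cdots(1-wq^{k-1})$ with $(w;q)_0=1$; so $(yq;q)_i=\prod_{j=1}^{i}(1-yq^j)$. The Gauss polynomial is ${n \brack i}=\frac{(q;q)_n}{(q;q)_i\,(q;q)_{n-i}}$. -}

module Defs where

open import Data.Nat as ℕ using (ℕ; zero; suc)
open import Data.Nat.Combinatorics using (_C_)
open import Data.Rational using (ℚ; 0ℚ; 1ℚ; _+_; _*_; _-_; -_; 1/_; ≢-nonZero)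
open import Data.Rational.Properties using (_≟_)
open import Relation.Nullary using (yes; no)

_^_ : ℚ → ℕ → ℚ
x ^ zero  = 1ℚ
x ^ suc k = x * (x ^ k)

-- total inverse (inv 0 = 0); only ever applied to nonzero arguments
-- under the hypotheses of the theorem
inv : ℚ → ℚ
inv p with p ≟ 0ℚ
... | yes _  = 0ℚ
... | no p≢0 = 1/_ p {{≢-nonZero p≢0}}

_÷_ : ℚ → ℚ → ℚ
a ÷ b = a * inv b

qPoch : ℚ → ℚ → ℕ → ℚ
qPoch w q zero    = 1ℚ
qPoch w q (suc k) = qPoch w q k * (1ℚ - w * (q ^ k))

gauss : ℚ → ℕ → ℕ → ℚ
gauss q n i = qPoch q q n ÷ (qPoch q q i * qPoch q q (n ℕ.∸ i))

sum1 : ℕ → (ℕ → ℚ) → ℚ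
sum1 zero    f = 0ℚ
sum1 (suc n) f = sum1 n f + f (suc n)

lhs : ℚ → ℚ → ℕ → ℚ
lhs y q n = sum1 n λ i →
  gauss q n i * ((((- 1ℚ) ^ (i ℕ.∸ 1)) * (q ^ (suc i C 2))) ÷ (1ℚ - y * (q ^ i)))

rhs : ℚ → ℚ → ℕ → ℚ
rhs y q n = sum1 n λ i →
  ((q ^ i) * qPoch q q (i ℕ.∸ 1)) ÷ qPoch (y * q) q i

-- Let t_z(j) = (-1)^j q^C(j+1,2) / (1 - z q^j) and let [m, j] be the Gauss polynomial defined by
-- the q-Pascal rule [m+1, j+1] = [m, j+1] + q^(m-j) [m, j]; it agrees with the quotient `gauss`
-- as soon as no (q;q)_k vanishes. If f(j+1) = w q^(j+1) g(j), the Pascal rule turns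
-- Σ_i [m+1, i] f(i) into Σ_i [m, i] f(i) + w q^(m+1) Σ_j [m, j] g(j), since the product
-- q^(m-j) q^(j+1) = q^(m+1) does not depend on j. As t_z(j+1) = -q^(j+1) t_zq(j), induction
-- on m gives the partial fraction expansion Σ_{j=0}^m [m, j] t_z(j) = (q;q)_m / (z;q)_(m+1).
-- The left-hand summand at i = j+1 is q^(j+1) t_yq(j), so the left-hand side grows from n to
-- n+1 by q^(n+1) (q;q)_n / (yq;q)_(n+1), which is the (n+1)-st summand of the right-hand side.

module Submission where

open import Defs
open import Data.Nat using (ℕ; _≤_)
open import Data.Rational using (ℚ; 0ℚ; 1ℚ; _-_; _*_)
open import Relation.Binary.PropositionalEquality using (_≡_; _≢_)

open import Data.Nat as ℕ using (zero; suc; _∸_; _<_; z≤n; s≤s)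
open import Data.Nat.Properties
  using (≤-refl; m≤n⇒m≤1+n; +-suc; m+n∸m≡n; m+[n∸m]≡n; m∸n+n≡m; m∸n≤m; n∸n≡0)
import Data.Nat.Properties as ℕₚ
open import Data.Nat.Combinatorics using (_C_; nCk+nC[k+1]≡[n+1]C[k+1]; nC1≡n)
open import Data.Rational using (_+_; -_; ≢-nonZero)
open import Data.Rational.Properties
  using (_≟_; 1≢0; *-inverseʳ; *-zeroˡ; *-zeroʳ; *-identityˡ; *-identityʳ; *-assoc; *-comm
        ; *-distribˡ-+; *-distribʳ-+; +-identityˡ; +-identityʳ; +-assoc; heytingCommutativeRing)
open import Algebra.Apartness.Properties.HeytingCommutativeRing heytingCommutativeRing
  using (x#0y#0→xy#0)
open import Data.Rational.Solver using (module +-*-Solver)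
open import Relation.Binary.PropositionalEquality
  using (refl; sym; trans; cong; cong₂; subst; module ≡-Reasoning)
open import Relation.Nullary using (Dec; yes; no)
open import Data.Empty using (⊥-elim)
open +-*-Solver using (solve; _:+_; _:*_; _:-_; :-_; con; _:=_)
open ≡-Reasoning

*-invʳ : ∀ {x} → x ≢ 0ℚ → x * inv x ≡ 1ℚ
*-invʳ {x} x≢0 with x ≟ 0ℚ
... | yes x≡0 = ⊥-elim (x≢0 x≡0)
... | no  x≢0′ = *-inverseʳ x {{≢-nonZero x≢0′}}

inv-unique : ∀ {x y} → x * y ≡ 1ℚ → inv x ≡ y
inv-unique {x} {y} xy≡1 = begin
  inv x                ≡⟨ sym (*-identityʳ (inv x)) ⟩
  inv x * 1ℚ           ≡⟨ cong (inv x *_) (sym xy≡1) ⟩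
  inv x * (x * y)      ≡⟨ sym (*-assoc (inv x) x y) ⟩
  inv x * x * y        ≡⟨ cong (_* y) (trans (*-comm (inv x) x) (*-invʳ x≢0)) ⟩
  1ℚ * y               ≡⟨ *-identityˡ y ⟩
  y                    ∎
  where
  x≢0 : x ≢ 0ℚ
  x≢0 refl = 1≢0 (trans (sym xy≡1) (*-zeroˡ y))

-- No side conditions are needed, because inv 0ℚ = 0ℚ.
inv-distrib-* : ∀ x y → inv (x * y) ≡ inv x * inv y
inv-distrib-* x y = by-cases (x ≟ 0ℚ) (y ≟ 0ℚ)
  where
  by-cases : Dec (x ≡ 0ℚ) → Dec (y ≡ 0ℚ) → inv (x * y) ≡ inv x * inv y
  by-cases (yes refl) _ = trans (cong inv (*-zeroˡ y)) (sym (*-zeroˡ (inv y)))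
  by-cases (no _) (yes refl) = trans (cong inv (*-zeroʳ x)) (sym (*-zeroʳ (inv x)))
  by-cases (no x≢0) (no y≢0) = inv-unique {x * y} (begin
    x * y * (inv x * inv y)   ≡⟨ solve 4 (λ x y x′ y′ → x :* y :* (x′ :* y′) := x :* x′ :* (y :* y′))
                                       refl x y (inv x) (inv y) ⟩
    x * inv x * (y * inv y)   ≡⟨ cong₂ _*_ (*-invʳ x≢0) (*-invʳ y≢0) ⟩
    1ℚ * 1ℚ                   ≡⟨ *-identityˡ 1ℚ ⟩
    1ℚ                        ∎)

*-÷-cancelʳ : ∀ x {b} → b ≢ 0ℚ → (x * b) ÷ b ≡ x
*-÷-cancelʳ x {b} b≢0 = begin
  x * b * inv b     ≡⟨ *-assoc x b (inv b) ⟩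
  x * (b * inv b)   ≡⟨ cong (x *_) (*-invʳ b≢0) ⟩
  x * 1ℚ            ≡⟨ *-identityʳ x ⟩
  x                 ∎

÷-cancelʳ : ∀ x y {b} → b ≢ 0ℚ → (x * b) ÷ (y * b) ≡ x ÷ y
÷-cancelʳ x y {b} b≢0 = begin
  x * b * inv (y * b)           ≡⟨ cong (x * b *_) (inv-distrib-* y b) ⟩
  x * b * (inv y * inv b)       ≡⟨ solve 4 (λ x b y′ b′ → x :* b :* (y′ :* b′) := x :* y′ :* (b :* b′))
                                         refl x b (inv y) (inv b) ⟩
  x * inv y * (b * inv b)       ≡⟨ cong (x * inv y *_) (*-invʳ b≢0) ⟩
  x * inv y * 1ℚ                ≡⟨ *-identityʳ (x * inv y) ⟩
  x * inv y                     ∎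

sum0 : ℕ → (ℕ → ℚ) → ℚ
sum0 zero    f = f 0
sum0 (suc m) f = sum0 m f + f (suc m)

sum1-ext : ∀ n {f g} → (∀ i → i ≤ n → f i ≡ g i) → sum1 n f ≡ sum1 n g
sum1-ext zero    f≡g = refl
sum1-ext (suc n) f≡g = cong₂ _+_ (sum1-ext n (λ i i≤n → f≡g i (m≤n⇒m≤1+n i≤n))) (f≡g (suc n) ≤-refl)

sum0-ext : ∀ m {f g} → (∀ j → j ≤ m → f j ≡ g j) → sum0 m f ≡ sum0 m g
sum0-ext zero    f≡g = f≡g 0 z≤n
sum0-ext (suc m) f≡g = cong₂ _+_ (sum0-ext m (λ j j≤m → f≡g j (m≤n⇒m≤1+n j≤m))) (f≡g (suc m) ≤-refl)

sum0-+ : ∀ m f g → sum0 m (λ j → f j + g j) ≡ sum0 m f + sum0 m g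
sum0-+ zero    f g = refl
sum0-+ (suc m) f g = begin
  sum0 m (λ j → f j + g j) + (f (suc m) + g (suc m))
    ≡⟨ cong (_+ (f (suc m) + g (suc m))) (sum0-+ m f g) ⟩
  sum0 m f + sum0 m g + (f (suc m) + g (suc m))
    ≡⟨ solve 4 (λ a b c d → a :+ b :+ (c :+ d) := a :+ c :+ (b :+ d))
             refl (sum0 m f) (sum0 m g) (f (suc m)) (g (suc m)) ⟩
  sum0 m f + f (suc m) + (sum0 m g + g (suc m)) ∎

sum0-* : ∀ m c f → sum0 m (λ j → c * f j) ≡ c * sum0 m f
sum0-* zero    c f = refl
sum0-* (suc m) c f = begin
  sum0 m (λ j → c * f j) + c * f (suc m)   ≡⟨ cong (_+ c * f (suc m)) (sum0-* m c f) ⟩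
  c * sum0 m f + c * f (suc m)             ≡⟨ sym (*-distribˡ-+ c (sum0 m f) (f (suc m))) ⟩
  c * (sum0 m f + f (suc m))               ∎

sum1-suc : ∀ m f → sum1 (suc m) f ≡ sum0 m (λ j → f (suc j))
sum1-suc zero    f = +-identityˡ (f 1)
sum1-suc (suc m) f = cong (_+ f (2 ℕ.+ m)) (sum1-suc m f)

sum0≡head+sum1 : ∀ m f → sum0 m f ≡ f 0 + sum1 m f
sum0≡head+sum1 zero    f = sym (+-identityʳ (f 0))
sum0≡head+sum1 (suc m) f = trans (cong (_+ f (suc m)) (sum0≡head+sum1 m f)) (+-assoc (f 0) (sum1 m f) (f (suc m)))

^-distribˡ-+-* : ∀ q a b → q ^ (a ℕ.+ b) ≡ q ^ a * q ^ b
^-distribˡ-+-* q zero    b = sym (*-identityˡ (q ^ b))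
^-distribˡ-+-* q (suc a) b = trans (cong (q *_) (^-distribˡ-+-* q a b)) (sym (*-assoc q (q ^ a) (q ^ b)))

^[m∸j]*^[1+j]≡^[1+m] : ∀ q {m j} → j ≤ m → q ^ (m ∸ j) * q ^ suc j ≡ q ^ suc m
^[m∸j]*^[1+j]≡^[1+m] q {m} {j} j≤m = begin
  q ^ (m ∸ j) * q ^ suc j     ≡⟨ sym (^-distribˡ-+-* q (m ∸ j) (suc j)) ⟩
  q ^ (m ∸ j ℕ.+ suc j)       ≡⟨ cong (q ^_) (trans (+-suc (m ∸ j) j) (cong suc (m∸n+n≡m j≤m))) ⟩
  q ^ suc m                   ∎

qPoch-suc-shift : ∀ z q k → qPoch z q (suc k) ≡ qPoch (z * q) q k * (1ℚ - z * q ^ 0)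
qPoch-suc-shift z q zero    = refl
qPoch-suc-shift z q (suc k) = begin
  qPoch z q (suc k) * (1ℚ - z * (q * q ^ k))
    ≡⟨ cong (_* (1ℚ - z * (q * q ^ k))) (qPoch-suc-shift z q k) ⟩
  qPoch (z * q) q k * (1ℚ - z * 1ℚ) * (1ℚ - z * (q * q ^ k))
    ≡⟨ solve 4 (λ p z q r → p :* (con 1ℚ :- z :* con 1ℚ) :* (con 1ℚ :- z :* (q :* r))
                           := p :* (con 1ℚ :- z :* q :* r) :* (con 1ℚ :- z :* con 1ℚ))
             refl (qPoch (z * q) q k) z q (q ^ k) ⟩
  qPoch (z * q) q k * (1ℚ - z * q * q ^ k) * (1ℚ - z * 1ℚ)
    ∎

qbinom : ℚ → ℕ → ℕ → ℚ
qbinom q m       zero    = 1ℚ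
qbinom q zero    (suc j) = 0ℚ
qbinom q (suc m) (suc j) = qbinom q m (suc j) + q ^ (m ∸ j) * qbinom q m j

m<j⇒qbinom≡0 : ∀ q {m j} → m < j → qbinom q m j ≡ 0ℚ
m<j⇒qbinom≡0 q {zero}  {suc j} _           = refl
m<j⇒qbinom≡0 q {suc m} {suc j} (s≤s m<j) = begin
  qbinom q m (suc j) + q ^ (m ∸ j) * qbinom q m j
    ≡⟨ cong₂ (λ u v → u + q ^ (m ∸ j) * v)
             (m<j⇒qbinom≡0 q {m} {suc j} (m≤n⇒m≤1+n m<j)) (m<j⇒qbinom≡0 q m<j) ⟩
  0ℚ + q ^ (m ∸ j) * 0ℚ
    ≡⟨ solve 1 (λ x → con 0ℚ :+ x :* con 0ℚ := con 0ℚ) refl (q ^ (m ∸ j)) ⟩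
  0ℚ ∎

qbinom[m,m]≡1 : ∀ q m → qbinom q m m ≡ 1ℚ
qbinom[m,m]≡1 q zero    = refl
qbinom[m,m]≡1 q (suc m) = begin
  qbinom q m (suc m) + q ^ (m ∸ m) * qbinom q m m
    ≡⟨ cong₂ (λ u v → u + q ^ (m ∸ m) * v) (m<j⇒qbinom≡0 q {m} {suc m} ≤-refl) (qbinom[m,m]≡1 q m) ⟩
  0ℚ + q ^ (m ∸ m) * 1ℚ
    ≡⟨ cong (λ e → 0ℚ + q ^ e * 1ℚ) (n∸n≡0 m) ⟩
  1ℚ ∎

qFactorials-pascal-step : ∀ a b x y u v {p} → a * (x * (1ℚ - u) * y) ≡ p → b * (x * (y * (1ℚ - v))) ≡ p
  → (a + v * b) * (x * (1ℚ - u) * (y * (1ℚ - v))) ≡ p * (1ℚ - u * v)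
qFactorials-pascal-step a b x y u v {p} ≡p ≡p′ = begin
  (a + v * b) * (x * (1ℚ - u) * (y * (1ℚ - v)))
    ≡⟨ solve 6 (λ a b x y u v → (a :+ v :* b) :* (x :* (con 1ℚ :- u) :* (y :* (con 1ℚ :- v)))
                               := a :* (x :* (con 1ℚ :- u) :* y) :* (con 1ℚ :- v)
                                  :+ v :* (con 1ℚ :- u) :* (b :* (x :* (y :* (con 1ℚ :- v)))))
             refl a b x y u v ⟩
  a * (x * (1ℚ - u) * y) * (1ℚ - v) + v * (1ℚ - u) * (b * (x * (y * (1ℚ - v))))
    ≡⟨ cong₂ (λ s t → s * (1ℚ - v) + v * (1ℚ - u) * t) ≡p ≡p′ ⟩
  p * (1ℚ - v) + v * (1ℚ - u) * p
    ≡⟨ solve 3 (λ p u v → p :* (con 1ℚ :- v) :+ v :* (con 1ℚ :- u) :* p := p :* (con 1ℚ :- u :* v)) refl p u v ⟩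
  p * (1ℚ - u * v) ∎

qbinom-qFactorials : ∀ q j k → qbinom q (j ℕ.+ k) j * (qPoch q q j * qPoch q q k) ≡ qPoch q q (j ℕ.+ k)
qbinom-qFactorials q zero    k = trans (*-identityˡ _) (*-identityˡ _)
qbinom-qFactorials q (suc j) zero rewrite ℕₚ.+-identityʳ j = begin
  qbinom q (suc j) (suc j) * (qPoch q q (suc j) * 1ℚ) ≡⟨ cong (_* (qPoch q q (suc j) * 1ℚ)) (qbinom[m,m]≡1 q (suc j)) ⟩
  1ℚ * (qPoch q q (suc j) * 1ℚ)                       ≡⟨ *-identityˡ _ ⟩
  qPoch q q (suc j) * 1ℚ                              ≡⟨ *-identityʳ _ ⟩
  qPoch q q (suc j)                                   ∎
qbinom-qFactorials q (suc j) (suc k) = begin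
  (qbinom q N (suc j) + q ^ (N ∸ j) * qbinom q N j) * (qPoch q q (suc j) * qPoch q q (suc k))
    ≡⟨ cong (λ e → (qbinom q N (suc j) + q ^ e * qbinom q N j) * (qPoch q q (suc j) * qPoch q q (suc k)))
            (m+n∸m≡n j (suc k)) ⟩
  (qbinom q N (suc j) + q ^ suc k * qbinom q N j) * (qPoch q q (suc j) * qPoch q q (suc k))
    ≡⟨ qFactorials-pascal-step (qbinom q N (suc j)) (qbinom q N j) (qPoch q q j) (qPoch q q k)
                               (q ^ suc j) (q ^ suc k) left right ⟩
  qPoch q q N * (1ℚ - q ^ suc j * q ^ suc k)
    ≡⟨ cong (λ w → qPoch q q N * (1ℚ - w)) (sym (^-distribˡ-+-* q (suc j) (suc k))) ⟩
  qPoch q q (suc N) ∎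
  where
  N = j ℕ.+ suc k
  left : qbinom q N (suc j) * (qPoch q q (suc j) * qPoch q q k) ≡ qPoch q q N
  left = subst (λ M → qbinom q M (suc j) * (qPoch q q (suc j) * qPoch q q k) ≡ qPoch q q M)
               (sym (+-suc j k)) (qbinom-qFactorials q (suc j) k)
  right : qbinom q N j * (qPoch q q j * qPoch q q (suc k)) ≡ qPoch q q N
  right = qbinom-qFactorials q j (suc k)

gauss≡qbinom : ∀ q {m j} → (∀ k → k ≤ m → qPoch q q k ≢ 0ℚ) → j ≤ m → gauss q m j ≡ qbinom q m j
gauss≡qbinom q {m} {j} qPoch≢0 j≤m = begin
  qPoch q q m ÷ D               ≡⟨ cong (_÷ D) (sym factorials) ⟩
  (qbinom q m j * D) ÷ D        ≡⟨ *-÷-cancelʳ (qbinom q m j) D≢0 ⟩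
  qbinom q m j                  ∎
  where
  D = qPoch q q j * qPoch q q (m ∸ j)
  D≢0 : D ≢ 0ℚ
  D≢0 = x#0y#0→xy#0 (qPoch≢0 j j≤m) (qPoch≢0 (m ∸ j) (m∸n≤m m j))
  factorials : qbinom q m j * D ≡ qPoch q q m
  factorials = subst (λ M → qbinom q M j * D ≡ qPoch q q M) (m+[n∸m]≡n j≤m) (qbinom-qFactorials q j (m ∸ j))

term : ℚ → ℚ → ℕ → ℚ
term q z j = ((- 1ℚ) ^ j * q ^ (suc j C 2)) ÷ (1ℚ - z * q ^ j)

lhsTerm : ℚ → ℚ → ℕ → ℚ
lhsTerm y q i = ((- 1ℚ) ^ (i ∸ 1) * q ^ (suc i C 2)) ÷ (1ℚ - y * q ^ i)

[2+j]C2≡[1+j]+[1+j]C2 : ∀ j → suc (suc j) C 2 ≡ suc j ℕ.+ (suc j C 2)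
[2+j]C2≡[1+j]+[1+j]C2 j =
  trans (sym (nCk+nC[k+1]≡[n+1]C[k+1] (suc j) 1)) (cong (ℕ._+ (suc j C 2)) (nC1≡n (suc j)))

lhsTerm-suc : ∀ y q j → lhsTerm y q (suc j) ≡ q ^ suc j * term q (y * q) j
lhsTerm-suc y q j = begin
  ((- 1ℚ) ^ j * q ^ (suc (suc j) C 2)) * inv (1ℚ - y * (q * q ^ j))
    ≡⟨ cong₂ (λ e w → ((- 1ℚ) ^ j * q ^ e) * inv (1ℚ - w)) ([2+j]C2≡[1+j]+[1+j]C2 j) (sym (*-assoc y q (q ^ j))) ⟩
  ((- 1ℚ) ^ j * q ^ (suc j ℕ.+ (suc j C 2))) * inv (1ℚ - y * q * q ^ j)
    ≡⟨ cong (λ w → ((- 1ℚ) ^ j * w) * inv (1ℚ - y * q * q ^ j)) (^-distribˡ-+-* q (suc j) (suc j C 2)) ⟩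
  ((- 1ℚ) ^ j * (q ^ suc j * q ^ (suc j C 2))) * inv (1ℚ - y * q * q ^ j)
    ≡⟨ solve 4 (λ s w c i → (s :* (w :* c)) :* i := w :* ((s :* c) :* i))
             refl ((- 1ℚ) ^ j) (q ^ suc j) (q ^ (suc j C 2)) (inv (1ℚ - y * q * q ^ j)) ⟩
  q ^ suc j * term q (y * q) j ∎

term-suc : ∀ q z j → term q z (suc j) ≡ - 1ℚ * (q ^ suc j * term q (z * q) j)
term-suc q z j = begin
  ((- 1ℚ) * (- 1ℚ) ^ j * q ^ (suc (suc j) C 2)) * inv (1ℚ - z * q ^ suc j)
    ≡⟨ solve 3 (λ s c i → ((:- con 1ℚ) :* s :* c) :* i := (:- con 1ℚ) :* ((s :* c) :* i))
             refl ((- 1ℚ) ^ j) (q ^ (suc (suc j) C 2)) (inv (1ℚ - z * q ^ suc j)) ⟩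
  - 1ℚ * lhsTerm z q (suc j)
    ≡⟨ cong (- 1ℚ *_) (lhsTerm-suc z q j) ⟩
  - 1ℚ * (q ^ suc j * term q (z * q) j) ∎

qbinom-sum1-suc : ∀ q m w (f g : ℕ → ℚ) → (∀ j → f (suc j) ≡ w * (q ^ suc j * g j))
  → sum1 (suc m) (λ i → qbinom q (suc m) i * f i)
    ≡ sum1 m (λ i → qbinom q m i * f i) + w * (q ^ suc m * sum0 m (λ j → qbinom q m j * g j))
qbinom-sum1-suc q m w f g f-suc = begin
  sum1 (suc m) (λ i → qbinom q (suc m) i * f i)
    ≡⟨ sum1-suc m (λ i → qbinom q (suc m) i * f i) ⟩
  sum0 m (λ j → (qbinom q m (suc j) + q ^ (m ∸ j) * qbinom q m j) * f (suc j))
    ≡⟨ sum0-ext m (λ j _ → *-distribʳ-+ (f (suc j)) (qbinom q m (suc j)) (q ^ (m ∸ j) * qbinom q m j)) ⟩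
  sum0 m (λ j → qbinom q m (suc j) * f (suc j) + q ^ (m ∸ j) * qbinom q m j * f (suc j))
    ≡⟨ sum0-+ m (λ j → qbinom q m (suc j) * f (suc j)) (λ j → q ^ (m ∸ j) * qbinom q m j * f (suc j)) ⟩
  sum0 m (λ j → qbinom q m (suc j) * f (suc j)) + sum0 m (λ j → q ^ (m ∸ j) * qbinom q m j * f (suc j))
    ≡⟨ cong₂ _+_ pascal-left pascal-right ⟩
  sum1 m (λ i → qbinom q m i * f i) + w * (q ^ suc m * sum0 m (λ j → qbinom q m j * g j)) ∎
  where
  pascal-left : sum0 m (λ j → qbinom q m (suc j) * f (suc j)) ≡ sum1 m (λ i → qbinom q m i * f i)
  pascal-left = begin
    sum0 m (λ j → qbinom q m (suc j) * f (suc j))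
      ≡⟨ sym (sum1-suc m (λ i → qbinom q m i * f i)) ⟩
    sum1 m (λ i → qbinom q m i * f i) + qbinom q m (suc m) * f (suc m)
      ≡⟨ cong (λ c → sum1 m (λ i → qbinom q m i * f i) + c * f (suc m)) (m<j⇒qbinom≡0 q {m} {suc m} ≤-refl) ⟩
    sum1 m (λ i → qbinom q m i * f i) + 0ℚ * f (suc m)
      ≡⟨ solve 2 (λ s x → s :+ con 0ℚ :* x := s) refl (sum1 m (λ i → qbinom q m i * f i)) (f (suc m)) ⟩
    sum1 m (λ i → qbinom q m i * f i) ∎
  pascal-right : sum0 m (λ j → q ^ (m ∸ j) * qbinom q m j * f (suc j))
                 ≡ w * (q ^ suc m * sum0 m (λ j → qbinom q m j * g j))
  pascal-right = begin
    sum0 m (λ j → q ^ (m ∸ j) * qbinom q m j * f (suc j))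
      ≡⟨ sum0-ext m powers-combine ⟩
    sum0 m (λ j → w * (q ^ suc m * (qbinom q m j * g j)))
      ≡⟨ sum0-* m w (λ j → q ^ suc m * (qbinom q m j * g j)) ⟩
    w * sum0 m (λ j → q ^ suc m * (qbinom q m j * g j))
      ≡⟨ cong (w *_) (sum0-* m (q ^ suc m) (λ j → qbinom q m j * g j)) ⟩
    w * (q ^ suc m * sum0 m (λ j → qbinom q m j * g j)) ∎
    where
    powers-combine : ∀ j → j ≤ m → q ^ (m ∸ j) * qbinom q m j * f (suc j) ≡ w * (q ^ suc m * (qbinom q m j * g j))
    powers-combine j j≤m = begin
      q ^ (m ∸ j) * qbinom q m j * f (suc j)
        ≡⟨ cong (q ^ (m ∸ j) * qbinom q m j *_) (f-suc j) ⟩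
      q ^ (m ∸ j) * qbinom q m j * (w * (q ^ suc j * g j))
        ≡⟨ solve 5 (λ e b w p x → e :* b :* (w :* (p :* x)) := w :* (e :* p :* (b :* x)))
                 refl (q ^ (m ∸ j)) (qbinom q m j) w (q ^ suc j) (g j) ⟩
      w * (q ^ (m ∸ j) * q ^ suc j * (qbinom q m j * g j))
        ≡⟨ cong (λ p → w * (p * (qbinom q m j * g j))) (^[m∸j]*^[1+j]≡^[1+m] q j≤m) ⟩
      w * (q ^ suc m * (qbinom q m j * g j)) ∎

qbinom-sum0-suc : ∀ q m w (f g : ℕ → ℚ) → (∀ j → f (suc j) ≡ w * (q ^ suc j * g j))
  → sum0 (suc m) (λ j → qbinom q (suc m) j * f j)
    ≡ sum0 m (λ j → qbinom q m j * f j) + w * (q ^ suc m * sum0 m (λ j → qbinom q m j * g j))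
qbinom-sum0-suc q m w f g f-suc = begin
  sum0 (suc m) (λ j → qbinom q (suc m) j * f j)
    ≡⟨ sum0≡head+sum1 (suc m) (λ j → qbinom q (suc m) j * f j) ⟩
  1ℚ * f 0 + sum1 (suc m) (λ j → qbinom q (suc m) j * f j)
    ≡⟨ cong (1ℚ * f 0 +_) (qbinom-sum1-suc q m w f g f-suc) ⟩
  1ℚ * f 0 + (sum1 m (λ j → qbinom q m j * f j) + R)
    ≡⟨ sym (+-assoc (1ℚ * f 0) (sum1 m (λ j → qbinom q m j * f j)) R) ⟩
  1ℚ * f 0 + sum1 m (λ j → qbinom q m j * f j) + R
    ≡⟨ cong (_+ R) (sym (sum0≡head+sum1 m (λ j → qbinom q m j * f j))) ⟩
  sum0 m (λ j → qbinom q m j * f j) + R ∎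
  where
  R = w * (q ^ suc m * sum0 m (λ j → qbinom q m j * g j))

≢0-reassoc : ∀ z q j → 1ℚ - z * q ^ suc j ≢ 0ℚ → 1ℚ - z * q * q ^ j ≢ 0ℚ
≢0-reassoc z q j = subst (_≢ 0ℚ) (cong (λ w → 1ℚ - w) (sym (*-assoc z q (q ^ j))))

qbinom-partialFractions : ∀ q m z → (∀ j → j ≤ m → 1ℚ - z * q ^ j ≢ 0ℚ)
  → sum0 m (λ j → qbinom q m j * term q z j) ≡ qPoch q q m ÷ qPoch z q (suc m)
qbinom-partialFractions q zero z _ = begin
  1ℚ * ((1ℚ * 1ℚ) * inv (1ℚ - z * 1ℚ))
    ≡⟨ solve 1 (λ i → con 1ℚ :* ((con 1ℚ :* con 1ℚ) :* i) := con 1ℚ :* i) refl (inv (1ℚ - z * 1ℚ)) ⟩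
  1ℚ * inv (1ℚ - z * 1ℚ)
    ≡⟨ cong (λ d → 1ℚ * inv d) (sym (*-identityˡ (1ℚ - z * 1ℚ))) ⟩
  1ℚ * inv (1ℚ * (1ℚ - z * 1ℚ)) ∎
qbinom-partialFractions q (suc m) z denom≢0 = begin
  S (suc m) z
    ≡⟨ qbinom-sum0-suc q m (- 1ℚ) (term q z) (term q (z * q)) (term-suc q z) ⟩
  S m z + - 1ℚ * (q ^ suc m * S m (z * q))
    ≡⟨ cong₂ (λ u v → u + - 1ℚ * (q ^ suc m * v)) (qbinom-partialFractions q m z denom≢0′)
                                                   (qbinom-partialFractions q m (z * q) shifted-denom≢0) ⟩
  P ÷ A + - 1ℚ * (q ^ suc m * (P ÷ B))
    -- common denominator C = (z;q)_(m+2) = A b = B a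
    ≡⟨ cong₂ (λ u v → u + - 1ℚ * (q ^ suc m * v)) (sym (÷-cancelʳ P A b≢0)) over-C ⟩
  (P * b) ÷ C + - 1ℚ * (q ^ suc m * ((P * a) ÷ C))
    ≡⟨ solve 5 (λ p i z q r → p :* (con 1ℚ :- z :* (q :* r)) :* i
                               :+ (:- con 1ℚ) :* (q :* r :* (p :* (con 1ℚ :- z :* con 1ℚ) :* i))
                             := p :* (con 1ℚ :- q :* r) :* i)
             refl P (inv C) z q (q ^ m) ⟩
  (P * (1ℚ - q * q ^ m)) ÷ C ∎
  where
  S : ℕ → ℚ → ℚ
  S k z′ = sum0 k (λ j → qbinom q k j * term q z′ j)
  P = qPoch q q m
  A = qPoch z q (suc m)
  B = qPoch (z * q) q (suc m)
  C = qPoch z q (suc (suc m))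
  a = 1ℚ - z * q ^ 0
  b = 1ℚ - z * q ^ suc m
  a≢0 : a ≢ 0ℚ
  a≢0 = denom≢0 0 z≤n
  b≢0 : b ≢ 0ℚ
  b≢0 = denom≢0 (suc m) ≤-refl
  denom≢0′ : ∀ j → j ≤ m → 1ℚ - z * q ^ j ≢ 0ℚ
  denom≢0′ j j≤m = denom≢0 j (m≤n⇒m≤1+n j≤m)
  shifted-denom≢0 : ∀ j → j ≤ m → 1ℚ - z * q * q ^ j ≢ 0ℚ
  shifted-denom≢0 j j≤m = ≢0-reassoc z q j (denom≢0 (suc j) (s≤s j≤m))
  over-C : P ÷ B ≡ (P * a) ÷ C
  over-C = begin
    P ÷ B               ≡⟨ sym (÷-cancelʳ P B a≢0) ⟩
    (P * a) ÷ (B * a)   ≡⟨ cong ((P * a) ÷_) (sym (qPoch-suc-shift z q (suc m))) ⟩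
    (P * a) ÷ C         ∎

qbinom-lhsTerm-sum≡rhs : ∀ y q n → (∀ i → 1 ≤ i → i ≤ n → 1ℚ - y * q ^ i ≢ 0ℚ)
  → sum1 n (λ i → qbinom q n i * lhsTerm y q i) ≡ rhs y q n
qbinom-lhsTerm-sum≡rhs y q zero    _       = refl
qbinom-lhsTerm-sum≡rhs y q (suc n) denom≢0 = begin
  sum1 (suc n) (λ i → qbinom q (suc n) i * lhsTerm y q i)
    ≡⟨ qbinom-sum1-suc q n 1ℚ (lhsTerm y q) (term q (y * q))
                       (λ j → trans (lhsTerm-suc y q j) (sym (*-identityˡ _))) ⟩
  sum1 n (λ i → qbinom q n i * lhsTerm y q i) + 1ℚ * (q ^ suc n * sum0 n (λ j → qbinom q n j * term q (y * q) j))
    ≡⟨ cong₂ (λ u v → u + 1ℚ * (q ^ suc n * v)) (qbinom-lhsTerm-sum≡rhs y q n denom≢0′)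
                                                (qbinom-partialFractions q n (y * q) shifted-denom≢0) ⟩
  rhs y q n + 1ℚ * (q ^ suc n * (qPoch q q n ÷ qPoch (y * q) q (suc n)))
    ≡⟨ cong (rhs y q n +_) (solve 3 (λ x p i → con 1ℚ :* (x :* (p :* i)) := x :* p :* i)
                                    refl (q ^ suc n) (qPoch q q n) (inv (qPoch (y * q) q (suc n)))) ⟩
  rhs y q (suc n) ∎
  where
  denom≢0′ : ∀ i → 1 ≤ i → i ≤ n → 1ℚ - y * q ^ i ≢ 0ℚ
  denom≢0′ i 1≤i i≤n = denom≢0 i 1≤i (m≤n⇒m≤1+n i≤n)
  shifted-denom≢0 : ∀ j → j ≤ n → 1ℚ - y * q * q ^ j ≢ 0ℚ
  shifted-denom≢0 j j≤n = ≢0-reassoc y q j (denom≢0 (suc j) (s≤s z≤n) (s≤s j≤n))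

mainTheorem2 : (n : ℕ) → 1 ≤ n → (y q : ℚ)
    → (∀ k → k ≤ n → qPoch q q k ≢ 0ℚ)
    → (∀ i → 1 ≤ i → i ≤ n → 1ℚ - y * (q ^ i) ≢ 0ℚ)
    → lhs y q n ≡ rhs y q n
mainTheorem2 n _ y q qPoch≢0 denom≢0 = begin
  lhs y q n                                     ≡⟨ sum1-ext n gauss≡qbinom-summand ⟩
  sum1 n (λ i → qbinom q n i * lhsTerm y q i)   ≡⟨ qbinom-lhsTerm-sum≡rhs y q n denom≢0 ⟩
  rhs y q n                                     ∎
  where
  gauss≡qbinom-summand : ∀ i → i ≤ n → gauss q n i * lhsTerm y q i ≡ qbinom q n i * lhsTerm y q i
  gauss≡qbinom-summand i i≤n = cong (_* lhsTerm y q i) (gauss≡qbinom q qPoch≢0 i≤n)
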